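{- A quasi-selective ultrafilter on $\mathbb N$ is selective if and only if it is rapid.
   Context: $\mathbb N=\{0,1,2,\dots\}$. $f\equiv_{\mathcal U}g$ means $\{n: f(n)=g(n)\}\in\mathcal U$. A nonprincipal ultrafilter $\mathcal U$ on $\mathbb N$ is quasi-selective if every $f:\mathbb N\to\mathbb N$ with $f(n)\le n$ for all $n$ is $\mathcal U$-equivalent to a nondecreasing function. A nonprincipal ultrafilter $\mathcal U$ is selective (Ramsey) iff every $f:\mathbb N\to\mathbb N$ is $\mathcal U$-equivalent to a nondecreasing function. $\mathcal U$ is rapid if for every increasing $f:\mathbb N\to\mathbb N$ there is $U=\{u_0<u_1<\cdots\}\in\mathcal U$ with $u_n>f(n)$ for all $n$. -}

module Defs where

open import Level using (0ℓ)
open import Data.Nat using (ℕ; _≤_; _<_)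
open import Data.Product using (Σ; ∃; _×_)
open import Data.Sum using (_⊎_)
open import Data.Unit using (⊤)
open import Data.Empty using (⊥)
open import Relation.Nullary using (¬_)
open import Relation.Unary using (Pred; _⊆_; _∩_; ∁)
open import Relation.Binary.PropositionalEquality using (_≡_)

Subset : Set₁
Subset = Pred ℕ 0ℓ

Family : Set₁
Family = Pred Subset 0ℓ

record IsUltrafilter (U : Family) : Set₁ where
  field
    full     : U (λ _ → ⊤)
    proper   : ¬ U (λ _ → ⊥)
    upward   : ∀ {A B : Subset} → A ⊆ B → U A → U B
    meet     : ∀ {A B : Subset} → U A → U B → U (A ∩ B)
    ultra    : ∀ (A : Subset) → U A ⊎ U (∁ A)

NonPrincipal : Family → Set
NonPrincipal U = ∀ (n : ℕ) → ¬ U (λ m → m ≡ n)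

_≡[_]_ : (ℕ → ℕ) → Family → (ℕ → ℕ) → Set
f ≡[ U ] g = U (λ n → f n ≡ g n)

Nondecreasing : (ℕ → ℕ) → Set
Nondecreasing g = ∀ {m n : ℕ} → m ≤ n → g m ≤ g n

StrictlyIncreasing : (ℕ → ℕ) → Set
StrictlyIncreasing g = ∀ {m n : ℕ} → m < n → g m < g n

QuasiSelective : Family → Set
QuasiSelective U = ∀ (f : ℕ → ℕ) → (∀ n → f n ≤ n) →
  ∃ λ g → Nondecreasing g × (f ≡[ U ] g)

Selective : Family → Set
Selective U = ∀ (f : ℕ → ℕ) → ∃ λ g → Nondecreasing g × (f ≡[ U ] g)

Rapid : Family → Set
Rapid U = ∀ (f : ℕ → ℕ) → StrictlyIncreasing f →
  ∃ λ (u : ℕ → ℕ) → StrictlyIncreasing u × U (λ m → ∃ λ n → u n ≡ m) × (∀ n → f n < u n)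

-- Selective ⇒ rapid: cut ℕ into consecutive blocks, block j + 1 being longer than f j.
-- The distance from m to the end of its block decreases strictly inside each block, so a
-- nondecreasing function U-equal to it agrees with it at most once per block; the points of
-- agreement, with the start of block n + 1 filling in when block n + 1 has none, enumerate a set
-- in U whose n-th element exceeds f n.
--
-- Quasi-selective ∧ rapid ⇒ selective: when f m ≤ m on a U-large set, quasi-selectivity applies
-- directly, so suppose m < f m U-almost everywhere. Choose blocks so that f sends every block below
-- the end of the next one, and use rapidity to get {u₀ < u₁ < ⋯} ∈ U with uₙ beyond the start of block
-- n. For m = uₙ the value (block m ∸ n) is at most m, so it is U-equal to a nondecreasing function;
-- since it decreases strictly along the points of one block, U contains a set meeting each block
-- at most once, and shrinking it to blocks of one parity leaves at least one block between any two
-- of its points. On such a set f is increasing, hence f is U-equal to a nondecreasing function.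
module Submission where

open import Defs
open import Function.Base using (_∘_)
open import Function.Bundles using (_⇔_; mk⇔)
open import Data.Nat
open import Data.Nat.Properties
open import Data.Parity.Base using (Parity; 0ℙ; 1ℙ)
import Data.Parity.Properties as Parityₚ
open import Data.Product using (∃; _×_; _,_; proj₁; proj₂)
open import Data.Sum using (inj₁; inj₂)
open import Data.Empty using (⊥-elim)
open import Relation.Nullary using (¬_; Dec; yes; no)
open import Relation.Nullary.Decidable using (_×-dec_)
open import Relation.Unary using (Decidable)
open import Relation.Binary.PropositionalEquality
  using (_≡_; _≢_; refl; sym; trans; cong; subst; subst₂)
open import Relation.Binary.Definitions using (tri<; tri≈; tri>)

nondecreasing-step : (s : ℕ → ℕ) → (∀ n → s n ≤ s (suc n)) → Nondecreasing s
nondecreasing-step s step {m} m≤n = go (≤⇒≤′ m≤n)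
  where
  go : ∀ {n} → m ≤′ n → s m ≤ s n
  go ≤′-refl         = ≤-refl
  go (≤′-step m≤′n) = ≤-trans (go m≤′n) (step _)

strictlyIncreasing-step : (s : ℕ → ℕ) → (∀ n → s n < s (suc n)) → StrictlyIncreasing s
strictlyIncreasing-step s step {m} m<n =
  <-≤-trans (step m) (nondecreasing-step s (<⇒≤ ∘ step) m<n)

strictlyIncreasing⇒nondecreasing : ∀ {s} → StrictlyIncreasing s → Nondecreasing s
strictlyIncreasing⇒nondecreasing s-inc m≤n with m≤n⇒m<n∨m≡n m≤n
... | inj₁ m<n  = <⇒≤ (s-inc m<n)
... | inj₂ refl = ≤-refl

nondecreasing-reflects-< : ∀ {s} → Nondecreasing s → ∀ {i j} → s i < s j → i < j
nondecreasing-reflects-< s-mono si<sj = ≰⇒> (λ j≤i → <⇒≱ si<sj (s-mono j≤i))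

strictlyIncreasing-reflects-≤ : ∀ {s} → StrictlyIncreasing s → ∀ {i j} → s i ≤ s j → i ≤ j
strictlyIncreasing-reflects-≤ s-inc si≤sj = ≮⇒≥ (λ j<i → <⇒≱ (s-inc j<i) si≤sj)

nondecreasing-∸-no-crossing : ∀ {g c x y} → Nondecreasing g → x < y → y ≤ c →
                              g x ≡ c ∸ x → g y ≢ c ∸ y
nondecreasing-∸-no-crossing g-mono x<y y≤c gx gy =
  <⇒≱ (∸-monoʳ-< x<y y≤c) (subst₂ _≤_ gx gy (g-mono (<⇒≤ x<y)))

nondecreasing-meets-∸-once : ∀ {g c x y} → Nondecreasing g → x ≤ c → y ≤ c →
                             g x ≡ c ∸ x → g y ≡ c ∸ y → x ≡ y
nondecreasing-meets-∸-once {x = x} {y} g-mono x≤c y≤c gx gy with <-cmp x y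
... | tri< x<y _ _ = ⊥-elim (nondecreasing-∸-no-crossing g-mono x<y y≤c gx gy)
... | tri≈ _ x≡y _ = x≡y
... | tri> _ _ y<x = ⊥-elim (nondecreasing-∸-no-crossing g-mono y<x x≤c gy gx)

same-parity-gap : ∀ {i j} → parity i ≡ parity j → i < j → 2 + i ≤ j
same-parity-gap {i} pi≡pj i<j with m≤n⇒m<n∨m≡n i<j
... | inj₁ 1+i<j = 1+i<j
... | inj₂ refl  = ⊥-elim (Parityₚ.p≢p⁻¹ (parity (suc i))
                            (trans (sym pi≡pj) (sym (Parityₚ.suc-homo-⁻¹ i))))

runningMax : (ℕ → ℕ) → ℕ → ℕ
runningMax f zero    = f zero
runningMax f (suc x) = runningMax f x ⊔ f (suc x)

≤-runningMax : ∀ f {i x} → i ≤ x → f i ≤ runningMax f x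
≤-runningMax f {zero}  {zero}  _   = ≤-refl
≤-runningMax f {i}     {suc x} i≤1+x with m≤n⇒m<n∨m≡n i≤1+x
... | inj₁ i<1+x = ≤-trans (≤-runningMax f (≤-pred i<1+x)) (m≤m⊔n _ (f (suc x)))
... | inj₂ refl  = m≤n⊔m (runningMax f x) (f (suc x))

monotoneOn⇒nondecreasing-extension :
  ∀ {Z : Subset} → Decidable Z → (f : ℕ → ℕ) → (∀ {x y} → Z x → Z y → x ≤ y → f x ≤ f y) →
  ∃ λ g → Nondecreasing g × (∀ {m} → Z m → f m ≡ g m)
monotoneOn⇒nondecreasing-extension {Z} Z? f f-mono =
  lastBelow ∘ suc , nondecreasing-step (lastBelow ∘ suc) (lastBelow-step ∘ suc) , agree
  where
  lastBelow : ℕ → ℕ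
  lastBelow zero = 0
  lastBelow (suc m) with Z? m
  ... | yes _ = f m
  ... | no _  = lastBelow m

  lastBelow≤ : ∀ m {y} → m ≤ y → Z y → lastBelow m ≤ f y
  lastBelow≤ zero    _   _  = z≤n
  lastBelow≤ (suc m) m<y zy with Z? m
  ... | yes zm = f-mono zm zy (<⇒≤ m<y)
  ... | no _   = lastBelow≤ m (<⇒≤ m<y) zy

  lastBelow-step : ∀ m → lastBelow m ≤ lastBelow (suc m)
  lastBelow-step m with Z? m
  ... | yes zm = lastBelow≤ m ≤-refl zm
  ... | no _   = ≤-refl

  agree : ∀ {m} → Z m → f m ≡ lastBelow (suc m)
  agree {m} zm with Z? m
  ... | yes _  = refl
  ... | no ¬zm = ⊥-elim (¬zm zm)

module UltrafilterFacts {U : Family} (uf : IsUltrafilter U) where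
  open IsUltrafilter uf

  initialSegment∉ : NonPrincipal U → ∀ N → ¬ U (_< N)
  initialSegment∉ np zero    U<0   = proper (upward (λ ()) U<0)
  initialSegment∉ np (suc N) U<1+N with ultra (_< N)
  ... | inj₁ U<N = initialSegment∉ np N U<N
  ... | inj₂ U≮N = np N (upward (λ (m<1+N , m≮N) → ≤-antisym (≤-pred m<1+N) (≮⇒≥ m≮N))
                                (meet U<1+N U≮N))

  finalSegment∈ : NonPrincipal U → ∀ N → U (N ≤_)
  finalSegment∈ np N with ultra (_< N)
  ... | inj₁ U<N = ⊥-elim (initialSegment∉ np N U<N)
  ... | inj₂ U≮N = upward ≮⇒≥ U≮N

  parity-class : (h : ℕ → ℕ) → ∃ λ p → U (λ m → parity (h m) ≡ p)
  parity-class h with ultra (λ m → parity (h m) ≡ 0ℙ)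
  ... | inj₁ even = 0ℙ , even
  ... | inj₂ odd  = 1ℙ , upward not-0ℙ odd
    where
    not-0ℙ : ∀ {p} → p ≢ 0ℙ → p ≡ 1ℙ
    not-0ℙ {0ℙ} p≢0 = ⊥-elim (p≢0 refl)
    not-0ℙ {1ℙ} _   = refl

  monotoneOn∈⇒nondecreasing-mod : ∀ {Z} → Decidable Z → U Z → (f : ℕ → ℕ) →
                                  (∀ {x y} → Z x → Z y → x ≤ y → f x ≤ f y) →
                                  ∃ λ g → Nondecreasing g × (f ≡[ U ] g)
  monotoneOn∈⇒nondecreasing-mod Z? UZ f f-mono
    with monotoneOn⇒nondecreasing-extension Z? f f-mono
  ... | g , g-mono , agree = g , g-mono , upward agree UZ

  quasiSelective-below-id : QuasiSelective U → (f : ℕ → ℕ) → U (λ m → f m ≤ m) →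
                            ∃ λ g → Nondecreasing g × (f ≡[ U ] g)
  quasiSelective-below-id qs f f≤id with qs (λ m → f m ⊓ m) (λ m → m⊓n≤n (f m) m)
  ... | g , g-mono , f⊓id≡g =
    g , g-mono , upward (λ (fm≤m , eq) → trans (sym (m≤n⇒m⊓n≡m fm≤m)) eq) (meet f≤id f⊓id≡g)

module Blocks (a : ℕ → ℕ) (a-zero : a 0 ≡ 0) (a-step : ∀ j → a j < a (suc j)) where

  a-inc : StrictlyIncreasing a
  a-inc = strictlyIncreasing-step a a-step

  a-mono : Nondecreasing a
  a-mono = strictlyIncreasing⇒nondecreasing a-inc

  block : ℕ → ℕ
  block zero = zero
  block (suc m) with a (suc (block m)) ≤? suc m
  ... | yes _ = suc (block m)
  ... | no _  = block m

  block-spec : ∀ m → a (block m) ≤ m × m < a (suc (block m))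
  block-spec zero = ≤-reflexive a-zero , subst (_< a 1) a-zero (a-step 0)
  block-spec (suc m) with a (suc (block m)) ≤? suc m | block-spec m
  ... | yes a≤1+m | _ , m<a = a≤1+m , ≤-<-trans m<a (a-step (suc (block m)))
  ... | no a≰1+m  | a≤m , _ = m≤n⇒m≤1+n a≤m , ≰⇒> a≰1+m

  block-mono : Nondecreasing block
  block-mono = nondecreasing-step block step
    where
    step : ∀ m → block m ≤ block (suc m)
    step m with a (suc (block m)) ≤? suc m
    ... | yes _ = n≤1+n (block m)
    ... | no _  = ≤-refl

  block≤id : ∀ m → block m ≤ m
  block≤id zero = z≤n
  block≤id (suc m) with a (suc (block m)) ≤? suc m
  ... | yes _ = s≤s (block≤id m)
  ... | no _  = m≤n⇒m≤1+n (block≤id m)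

module Rank (s : ℕ → ℕ) (s-inc : StrictlyIncreasing s) where

  rank : ℕ → ℕ
  rank zero = zero
  rank (suc m) with s (rank m) ≤? m
  ... | yes _ = suc (rank m)
  ... | no _  = rank m

  rank-spec : ∀ m → (∀ {j} → j < rank m → s j < m) × m ≤ s (rank m)
  rank-spec zero = (λ ()) , z≤n
  rank-spec (suc m) with s (rank m) ≤? m | rank-spec m
  ... | yes s≤m | _ , m≤s =
    (λ j<1+r → s≤s (≤-trans (strictlyIncreasing⇒nondecreasing s-inc (≤-pred j<1+r)) s≤m)) ,
    ≤-<-trans m≤s (s-inc (n<1+n (rank m)))
  ... | no s≰m  | below , _ = (λ j<r → m<n⇒m<1+n (below j<r)) , ≰⇒> s≰m

  rank-inverse : ∀ n → rank (s n) ≡ n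
  rank-inverse n = ≤-antisym
    (≮⇒≥ (λ n<r → <-irrefl refl (proj₁ (rank-spec (s n)) n<r)))
    (strictlyIncreasing-reflects-≤ s-inc (proj₂ (rank-spec (s n))))

module SelectiveDominates {U : Family} (uf : IsUltrafilter U) (np : NonPrincipal U)
                          (sel : Selective U) (f : ℕ → ℕ) where
  open IsUltrafilter uf
  open UltrafilterFacts uf

  a : ℕ → ℕ
  a zero    = zero
  a (suc j) = suc (a j + f j)

  open Blocks a refl (λ j → s≤s (m≤m+n (a j) (f j)))

  distanceToBlockEnd : ℕ → ℕ
  distanceToBlockEnd m = a (suc (block m)) ∸ m

  g : ℕ → ℕ
  g = proj₁ (sel distanceToBlockEnd)

  g-mono : Nondecreasing g
  g-mono = proj₁ (proj₂ (sel distanceToBlockEnd))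

  distance≡g : U (λ m → distanceToBlockEnd m ≡ g m)
  distance≡g = proj₂ (proj₂ (sel distanceToBlockEnd))

  MeetsInBlock : ℕ → ℕ → Set
  MeetsInBlock n x = a (suc n) ≤ x × g x ≡ a (2 + n) ∸ x

  meetsInBlock? : ∀ n → Dec (∃ λ x → x < a (2 + n) × MeetsInBlock n x)
  meetsInBlock? n =
    anyUpTo? (λ x → a (suc n) ≤? x ×-dec g x ≟ a (2 + n) ∸ x) (a (2 + n))

  u : ℕ → ℕ
  u n with meetsInBlock? n
  ... | yes (x , _) = x
  ... | no _        = a (suc n)

  u-in-block : ∀ n → a (suc n) ≤ u n × u n < a (2 + n)
  u-in-block n with meetsInBlock? n
  ... | yes (x , x<a , a≤x , _) = a≤x , x<a
  ... | no _                    = ≤-refl , a-inc (n<1+n (suc n))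

  u-captures : ∀ {n m} → m < a (2 + n) → MeetsInBlock n m → u n ≡ m
  u-captures {n} {m} m<a meets with meetsInBlock? n
  ... | yes (x , x<a , _ , gx) =
    nondecreasing-meets-∸-once g-mono (<⇒≤ x<a) (<⇒≤ m<a) gx (proj₂ meets)
  ... | no none = ⊥-elim (none (m , m<a , meets))

  u-inc : StrictlyIncreasing u
  u-inc {m} {n} m<n =
    <-≤-trans (proj₂ (u-in-block m)) (≤-trans (a-mono (s≤s m<n)) (proj₁ (u-in-block n)))

  f<u : ∀ n → f n < u n
  f<u n = <-≤-trans (s≤s (m≤n+m (f n) (a n))) (proj₁ (u-in-block n))

  covered : ∀ {m} → a 1 ≤ m × distanceToBlockEnd m ≡ g m → ∃ λ n → u n ≡ m
  covered {m} (a₁≤m , distance≡gm) with block m | block-spec m | distance≡gm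
  ... | zero  | _ , m<a₁  | _  = ⊥-elim (<⇒≱ m<a₁ a₁≤m)
  ... | suc n | a≤m , m<a | eq = n , u-captures m<a (a≤m , sym eq)

  dominating : ∃ λ u → StrictlyIncreasing u × U (λ m → ∃ λ n → u n ≡ m) × (∀ n → f n < u n)
  dominating = u , u-inc , upward covered (meet (finalSegment∈ np (a 1)) distance≡g) , f<u

selective⇒rapid : (U : Family) → IsUltrafilter U → NonPrincipal U → Selective U → Rapid U
selective⇒rapid U uf np sel f _ = SelectiveDominates.dominating uf np sel f

module RapidSelects {U : Family} (uf : IsUltrafilter U) (qs : QuasiSelective U) (rap : Rapid U)
                    (f : ℕ → ℕ) (f>id : U (λ m → m < f m)) where
  open IsUltrafilter uf
  open UltrafilterFacts uf

  a : ℕ → ℕ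
  a zero    = zero
  a (suc j) = suc (a j + runningMax f (a j))

  open Blocks a refl (λ j → s≤s (m≤m+n (a j) (runningMax f (a j))))

  f-into-next-block : ∀ {K m} → m < a (suc K) → f m < a (2 + K)
  f-into-next-block {K} m<a =
    s≤s (≤-trans (≤-runningMax f (<⇒≤ m<a)) (m≤n+m _ (a (suc K))))

  u : ℕ → ℕ
  u = proj₁ (rap a a-inc)

  u-inc : StrictlyIncreasing u
  u-inc = proj₁ (proj₂ (rap a a-inc))

  range-u∈U : U (λ m → ∃ λ n → u n ≡ m)
  range-u∈U = proj₁ (proj₂ (proj₂ (rap a a-inc)))

  a<u : ∀ n → a n < u n
  a<u = proj₂ (proj₂ (proj₂ (rap a a-inc)))

  open Rank u u-inc

  rank≤block : ∀ {m} → u (rank m) ≡ m → rank m ≤ block m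
  rank≤block {m} u-rank≡m = ≤-pred (nondecreasing-reflects-< a-mono
    (<-trans (subst (a (rank m) <_) u-rank≡m (a<u (rank m))) (proj₂ (block-spec m))))

  c : ℕ → ℕ
  c m = block m ∸ rank m

  c≤id : ∀ m → c m ≤ m
  c≤id m = ≤-trans (m∸n≤m (block m) (rank m)) (block≤id m)

  h : ℕ → ℕ
  h = proj₁ (qs c c≤id)

  h-mono : Nondecreasing h
  h-mono = proj₁ (proj₂ (qs c c≤id))

  c≡h : U (λ m → c m ≡ h m)
  c≡h = proj₂ (proj₂ (qs c c≤id))

  p : Parity
  p = proj₁ (parity-class block)

  Good : Subset
  Good m = m < f m × u (rank m) ≡ m × c m ≡ h m × parity (block m) ≡ p

  good? : Decidable Good
  good? m = m <? f m ×-dec u (rank m) ≟ m ×-dec c m ≟ h m ×-dec parity (block m) Parityₚ.≟ p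

  good∈U : U Good
  good∈U = meet f>id (meet inRange (meet c≡h (proj₂ (parity-class block))))
    where
    inRange : U (λ m → u (rank m) ≡ m)
    inRange = upward (λ { (n , refl) → cong u (rank-inverse n) }) range-u∈U

  -- Two good points x < y in one block would have rank x < rank y ≤ block y, so c y < c x.
  good-blocks-distinct : ∀ {x y} → Good x → Good y → x < y → block x < block y
  good-blocks-distinct {x} {y} (_ , ux , cx≡hx , _) (_ , uy , cy≡hy , _) x<y =
    ≤∧≢⇒< (block-mono (<⇒≤ x<y)) sameBlock⇒⊥
    where
    rank-x<rank-y : rank x < rank y
    rank-x<rank-y = nondecreasing-reflects-< (strictlyIncreasing⇒nondecreasing u-inc)
                                             (subst₂ _<_ (sym ux) (sym uy) x<y)

    sameBlock⇒⊥ : block x ≢ block y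
    sameBlock⇒⊥ eq = <⇒≱ cy<cx (subst₂ _≤_ (sym cx≡hx) (sym cy≡hy) (h-mono (<⇒≤ x<y)))
      where
      cy<cx : c y < c x
      cy<cx = subst (λ b → b ∸ rank y < c x) eq
                    (∸-monoʳ-< rank-x<rank-y (subst (rank y ≤_) (sym eq) (rank≤block uy)))

  f-monoOn-good : ∀ {x y} → Good x → Good y → x ≤ y → f x ≤ f y
  f-monoOn-good {x} {y} gx gy x≤y with m≤n⇒m<n∨m≡n x≤y
  ... | inj₂ refl = ≤-refl
  ... | inj₁ x<y  = <⇒≤ (<-trans fx<y (proj₁ gy))
    where
    blockGap : 2 + block x ≤ block y
    blockGap = same-parity-gap (trans (proj₂ (proj₂ (proj₂ gx))) (sym (proj₂ (proj₂ (proj₂ gy)))))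
                               (good-blocks-distinct gx gy x<y)

    fx<y : f x < y
    fx<y = <-≤-trans (f-into-next-block {block x} (proj₂ (block-spec x)))
                     (≤-trans (a-mono blockGap) (proj₁ (block-spec y)))

  selects : ∃ λ g → Nondecreasing g × (f ≡[ U ] g)
  selects = monotoneOn∈⇒nondecreasing-mod good? good∈U f f-monoOn-good

quasiSelective∧rapid⇒selective : (U : Family) → IsUltrafilter U → QuasiSelective U → Rapid U →
                                 Selective U
quasiSelective∧rapid⇒selective U uf qs rap f with IsUltrafilter.ultra uf (λ m → f m ≤ m)
... | inj₁ f≤id = UltrafilterFacts.quasiSelective-below-id uf qs f f≤id
... | inj₂ f≰id = RapidSelects.selects uf qs rap f (IsUltrafilter.upward uf ≰⇒> f≰id)

corollary1p6 : (U : Family) → IsUltrafilter U → NonPrincipal U → QuasiSelective U →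
    Selective U ⇔ Rapid U
corollary1p6 U uf np qs = mk⇔ (selective⇒rapid U uf np) (quasiSelective∧rapid⇒selective U uf qs)
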